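{- Let $p$ be a prime and $m$ a positive integer, and suppose that for every coset $D$ of $p^m\mathbb Z_p$ in $\mathbb Z_p$ an element $\alpha_D\in D$ is chosen. Then there is a $\mathrm{pReLU}$-network of width $2$ (input and output dimension $1$) which computes the function $f:\mathbb Z_p\to\mathbb Z_p$ such that $f(x)=\alpha_D$ whenever $x\in\alpha_D+p^m\mathbb Z_p$.
   Context: $\mathbb Q_p$ denotes the $p$-adic numbers and $\mathbb Z_p$ the $p$-adic integers. The function $\mathrm{pReLU}:\mathbb Q_p\to\mathbb Q_p$ is defined by $\mathrm{pReLU}(x)=x$ if $x\in\mathbb Z_p$ and $0$ otherwise. A $\mathrm{pReLU}$-network with input dimension $d_x$, output dimension $d_y$ and hidden layer dimensions $d_1,\dots,d_{L-1}$ is a composition $t_L\circ\Sigma_{L-1}\circ t_{L-1}\circ\cdots\circ t_2\circ\Sigma_1\circ t_1:\mathbb Q_p^{d_x}\to\mathbb Q_p^{d_y}$, where (with $d_0=d_x$, $d_L=d_y$) each $t_l:\mathbb Q_p^{d_{l-1}}\to\mathbb Q_p^{d_l}$ is an affine map with coefficients in $\mathbb Q_p$ and $\Sigma_l$ applies $\mathrm{pReLU}$ to each coordinate. Its width is $\max(d_1,\dots,d_{L-1})$. A network computes a function $f$ on a set $X$ if its restriction to $X$ equals $f$. -}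

module Defs where

open import Data.Nat using (ℕ; zero; suc; _+_; _*_; _^_; _<_; _⊔_; _≡ᵇ_; NonZero)
open import Data.Nat.Properties using (m^n≢0)
open import Data.Nat.DivMod using (_mod_)
open import Data.Nat.Base using (_/_)
open import Data.Fin using (Fin; toℕ) renaming (zero to fzero; suc to fsuc)
open import Data.Bool using (Bool; true; false; _∧_; if_then_else_)
open import Data.Product using (_×_; _,_; proj₁; proj₂)
open import Relation.Binary.PropositionalEquality using (_≡_)

module PAdic (p : ℕ) .{{nz : NonZero p}} where

  pow : ℕ → ℕ
  pow n = p ^ n

  -- ℤ_p : p-adic integers as digit streams  x = Σ_i d_i p^i,  d_i ∈ {0,…,p-1}
  Zp : Set
  Zp = ℕ → Fin p

  -- x mod p^n, i.e. the natural number Σ_{i<n} d_i p^i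
  res : ℕ → Zp → ℕ
  res zero    x = 0
  res (suc n) x = res n x + toℕ (x n) * p ^ n

  -- n-th digit of any natural number congruent to the target modulo p^(n+1)
  digitOf : ℕ → ℕ → Fin p
  digitOf n X = (_/_ X (p ^ n) {{m^n≢0 p n}}) mod p

  _≈Z_ : Zp → Zp → Set
  x ≈Z y = ∀ n → x n ≡ y n

  fromℕZ : ℕ → Zp
  fromℕZ c n = digitOf n c

  0Z : Zp
  0Z = fromℕZ 0

  _+Z_ : Zp → Zp → Zp
  (x +Z y) n = digitOf n (res (suc n) x + res (suc n) y)

  _*Z_ : Zp → Zp → Zp
  (x *Z y) n = digitOf n (res (suc n) x * res (suc n) y)

  -- ℚ_p : pairs (k , u) representing u / p^k with u ∈ ℤ_p
  Qp : Set
  Qp = ℕ × Zp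

  _≈Q_ : Qp → Qp → Set
  (k , u) ≈Q (l , v) = (fromℕZ (p ^ l) *Z u) ≈Z (fromℕZ (p ^ k) *Z v)

  ι : Zp → Qp
  ι u = (0 , u)

  0Q : Qp
  0Q = ι 0Z

  _+Q_ : Qp → Qp → Qp
  (k , u) +Q (l , v) = (k + l , (fromℕZ (p ^ l) *Z u) +Z (fromℕZ (p ^ k) *Z v))

  _*Q_ : Qp → Qp → Qp
  (k , u) *Q (l , v) = (k + l , u *Z v)

  -- (k , u) lies in ℤ_p iff u ≡ 0 mod p^k, i.e. its first k digits vanish
  firstZero : ℕ → Zp → Bool
  firstZero zero    u = true
  firstZero (suc k) u = (toℕ (u k) ≡ᵇ 0) ∧ firstZero k u

  inZp? : Qp → Bool
  inZp? (k , u) = firstZero k u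

  pReLU : Qp → Qp
  pReLU x = if inZp? x then x else 0Q

  Vecp : ℕ → Set
  Vecp d = Fin d → Qp

  sumQ : (n : ℕ) → (Fin n → Qp) → Qp
  sumQ zero    f = 0Q
  sumQ (suc n) f = f fzero +Q sumQ n (λ i → f (fsuc i))

  record Affine (d e : ℕ) : Set where
    field
      mat  : Fin e → Fin d → Qp
      bias : Fin e → Qp

  applyAff : ∀ {d e} → Affine d e → Vecp d → Vecp e
  applyAff {d} t x i = sumQ d (λ j → Affine.mat t i j *Q x j) +Q Affine.bias t i

  Σp : ∀ {d} → Vecp d → Vecp d
  Σp x i = pReLU (x i)

  -- pReLU networks  t_L ∘ Σ ∘ t_{L-1} ∘ ⋯ ∘ Σ ∘ t_1  from ℚ_p^d to ℚ_p^e
  data Net : ℕ → ℕ → Set where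
    output : ∀ {d e} → Affine d e → Net d e
    hidden : ∀ {d k e} → Affine d k → Net k e → Net d e

  eval : ∀ {d e} → Net d e → Vecp d → Vecp e
  eval (output t)   x = applyAff t x
  eval (hidden t N) x = eval N (Σp (applyAff t x))

  width : ∀ {d e} → Net d e → ℕ
  width (output t)           = 0
  width (hidden {k = k} t N) = k ⊔ width N

{-# OPTIONS --safe #-}
module Submission where

-- The network keeps a state (z , (z − c)/p^m) in ℚ_p², from which a candidate c is read off
-- affinely as z − p^m · (z − c)/p^m. It starts with c = x and has one hidden layer for each
-- representative a, mapping the state to (c , pReLU ((c − a)/p^m)). As (c − a)/p^m lies in ℤ_p
-- exactly when c ≡ a (mod p^m), this is the state for a if c ≡ a and the state for c otherwise,
-- so after all representatives c is the representative of the class of x. Equalities in ℚ_p are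
-- verified through residues modulo every p^n.

open import Defs
open import Data.Nat using (ℕ; _^_; _>_; NonZero)
open import Data.Nat.Primality using (Prime)
open import Data.Fin using (Fin; toℕ) renaming (zero to fzero)
open import Data.Product using (Σ; _×_)
open import Relation.Binary.PropositionalEquality using (_≡_)

open import Data.Nat as ℕ using (zero; suc; _<_; _%_; _/_)
import Data.Nat.Properties as ℕ
import Data.Nat.Divisibility as ℕ
open import Data.Nat.DivMod using (m≡m%n+[m/n]*n; m∣n⇒o%n%m≡o%m; m%[n*o]/o≡m/o%n; m%n<n; n%1≡0)
open import Data.Integer as ℤ using (ℤ; +_; _+_; _*_; _-_; -_; 0ℤ; 1ℤ; -1ℤ)
import Data.Integer.Properties as ℤ
open import Data.Integer.Divisibility.Signed
open import Data.Integer.Tactic.RingSolver using (solve-∀)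
open import Algebra.Properties.CommutativeSemigroup ℕ.+-commutativeSemigroup using (xy∙z≈xz∙y)
open import Algebra.Properties.CommutativeSemigroup ℤ.*-commutativeSemigroup using (x∙yz≈y∙xz)
open import Data.Fin using (fromℕ<) renaming (suc to fsuc)
import Data.Fin.Properties as Fin
open import Data.Bool using (T; if_then_else_)
open import Data.Bool.Properties using (T-∧; T-≡; ¬-not)
open import Data.Product using (_,_; proj₁; proj₂)
open import Data.Sum using (_⊎_; inj₁; inj₂)
open import Data.List using (List; []; _∷_; foldl; map; allFin)
open import Data.List.Relation.Unary.Any using (here; there)
open import Data.List.Membership.Propositional using (_∈_)
open import Data.List.Membership.Propositional.Properties using (∈-allFin)
open import Function.Base using (_∘_)
open import Function.Bundles using (_⇔_; mk⇔; module Equivalence)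
open import Relation.Nullary using (¬_; contradiction; yes; no)
open import Relation.Binary.Bundles using (Setoid)
open import Relation.Binary.Structures using (IsEquivalence)
import Relation.Binary.Reasoning.Setoid as SetoidReasoning
open import Relation.Binary.PropositionalEquality
  using (refl; sym; trans; cong; cong₂; subst; subst₂; module ≡-Reasoning)

infix 4 _≡_[mod_]
record _≡_[mod_] (x y : ℤ) (n : ℕ) : Set where
  constructor mod-intro
  field divides-difference : + n ∣ x - y

module _ {n : ℕ} where

  ≡⇒≡-mod : ∀ {x y} → x ≡ y → x ≡ y [mod n ]
  ≡⇒≡-mod {x} refl = mod-intro (divides 0ℤ (trans (ℤ.+-inverseʳ x) (sym (ℤ.*-zeroˡ (+ n)))))

  ≡-mod-refl : ∀ {x} → x ≡ x [mod n ]
  ≡-mod-refl = ≡⇒≡-mod refl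

  ≡-mod-sym : ∀ {x y} → x ≡ y [mod n ] → y ≡ x [mod n ]
  ≡-mod-sym {x} {y} (mod-intro d) = mod-intro (subst (+ n ∣_) (flip x y) (∣m⇒∣-m d))
    where flip : ∀ x y → - (x - y) ≡ y - x
          flip = solve-∀

  ≡-mod-trans : ∀ {x y z} → x ≡ y [mod n ] → y ≡ z [mod n ] → x ≡ z [mod n ]
  ≡-mod-trans {x} {y} {z} (mod-intro d) (mod-intro e) =
    mod-intro (subst (+ n ∣_) (telescope x y z) (∣m∣n⇒∣m+n d e))
    where telescope : ∀ x y z → (x - y) + (y - z) ≡ x - z
          telescope = solve-∀

  +-cong-mod : ∀ {x y u v} → x ≡ y [mod n ] → u ≡ v [mod n ] → x + u ≡ y + v [mod n ]
  +-cong-mod {x} {y} {u} {v} (mod-intro d) (mod-intro e) =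
    mod-intro (subst (+ n ∣_) (regroup x y u v) (∣m∣n⇒∣m+n d e))
    where regroup : ∀ x y u v → (x - y) + (u - v) ≡ (x + u) - (y + v)
          regroup = solve-∀

  -‿cong-mod : ∀ {x y} → x ≡ y [mod n ] → - x ≡ - y [mod n ]
  -‿cong-mod {x} {y} (mod-intro d) = mod-intro (subst (+ n ∣_) (negate x y) (∣m⇒∣-m d))
    where negate : ∀ x y → - (x - y) ≡ - x - - y
          negate = solve-∀

  *-cong-mod : ∀ {x y u v} → x ≡ y [mod n ] → u ≡ v [mod n ] → x * u ≡ y * v [mod n ]
  *-cong-mod {x} {y} {u} {v} (mod-intro d) (mod-intro e) =
    mod-intro (subst (+ n ∣_) (expand x y u v) (∣m∣n⇒∣m+n (∣n⇒∣m*n x e) (∣m⇒∣m*n v d)))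
    where expand : ∀ x y u v → x * (u - v) + (x - y) * v ≡ x * u - y * v
          expand = solve-∀

  *-congˡ-mod : ∀ x {u v} → u ≡ v [mod n ] → x * u ≡ x * v [mod n ]
  *-congˡ-mod x = *-cong-mod (≡-mod-refl {x})

  *-congʳ-mod : ∀ x {u v} → u ≡ v [mod n ] → u * x ≡ v * x [mod n ]
  *-congʳ-mod x u≡v = *-cong-mod u≡v (≡-mod-refl {x})

  ≡-mod-isEquivalence : IsEquivalence _≡_[mod n ]
  ≡-mod-isEquivalence = record { refl = ≡-mod-refl ; sym = ≡-mod-sym ; trans = ≡-mod-trans }

≡-mod-setoid : ℕ → Setoid _ _
≡-mod-setoid n = record { isEquivalence = ≡-mod-isEquivalence {n} }

module ≡-mod-Reasoning (n : ℕ) = SetoidReasoning (≡-mod-setoid n)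

x-y≡0⇒x≡y-mod : ∀ {n x y} → x - y ≡ 0ℤ [mod n ] → x ≡ y [mod n ]
x-y≡0⇒x≡y-mod {n} {x} {y} (mod-intro d) = mod-intro (subst (+ n ∣_) (ℤ.+-identityʳ (x - y)) d)

x≡y⇒x-y≡0-mod : ∀ {n x y} → x ≡ y [mod n ] → x - y ≡ 0ℤ [mod n ]
x≡y⇒x-y≡0-mod {n} {x} {y} (mod-intro d) = mod-intro (subst (+ n ∣_) (sym (ℤ.+-identityʳ (x - y))) d)

≡-mod-1 : ∀ {x y} → x ≡ y [mod 1 ]
≡-mod-1 {x} {y} = mod-intro (divides (x - y) (sym (ℤ.*-identityʳ (x - y))))

+-multiple-≡-mod : ∀ {n} a k → + (a ℕ.+ k ℕ.* n) ≡ + a [mod n ]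
+-multiple-≡-mod {n} a k = mod-intro (divides (+ k) (begin
  + (a ℕ.+ k ℕ.* n) - + a     ≡⟨ cong (_- + a) (trans (ℤ.pos-+ a (k ℕ.* n)) (cong (_+_ (+ a)) (ℤ.pos-* k n))) ⟩
  + a + + k * + n - + a       ≡⟨ cancel (+ a) (+ k * + n) ⟩
  + k * + n                   ∎))
  where open ≡-Reasoning
        cancel : ∀ a b → a + b - a ≡ b
        cancel = solve-∀

%-≡-mod : ∀ a n .{{_ : NonZero n}} → + (a % n) ≡ + a [mod n ]
%-≡-mod a n = ≡-mod-sym (subst (λ t → + t ≡ + (a % n) [mod n ]) (sym (m≡m%n+[m/n]*n a n))
                                (+-multiple-≡-mod (a % n) (a / n)))

≡-mod⇒≡ : ∀ {n a b} → a < n → b < n → + a ≡ + b [mod n ] → a ≡ b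
≡-mod⇒≡ {n} {a} {b} a<n b<n (mod-intro d) =
  ℤ.+-injective (ℤ.i-j≡0⇒i≡j (+ a) (+ b) (ℤ.∣i∣≡0⇒i≡0 (small-multiple (∣⇒∣ᵤ d) distance<n)))
  where
    distance<n : ℤ.∣ + a - + b ∣ < n
    distance<n = ℕ.≤-<-trans
      (subst (ℕ._≤ a ℕ.⊔ b) (cong ℤ.∣_∣ (sym (ℤ.m-n≡m⊖n a b))) (ℤ.∣m⊝n∣≤m⊔n a b))
      (ℕ.⊔-lub a<n b<n)
    small-multiple : ∀ {k} → n ℕ.∣ k → k < n → k ≡ 0
    small-multiple {zero}  _   _   = refl
    small-multiple {suc k} n∣k k<n = contradiction (ℕ.∣⇒≤ n∣k) (ℕ.<⇒≱ k<n)

*-scale-mod : ∀ k {n x y} → x ≡ y [mod n ] → + k * x ≡ + k * y [mod k ℕ.* n ]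
*-scale-mod k {n} {x} {y} (mod-intro d) =
  mod-intro (subst₂ _∣_ (sym (ℤ.pos-* k n)) (distrib (+ k) x y) (*-monoʳ-∣ (+ k) d))
  where distrib : ∀ k x y → k * (x - y) ≡ k * x - k * y
        distrib = solve-∀

*-cancel-mod : ∀ k {n x y} .{{_ : NonZero k}} → + k * x ≡ + k * y [mod k ℕ.* n ] → x ≡ y [mod n ]
*-cancel-mod k {n} {x} {y} (mod-intro d) =
  mod-intro (*-cancelˡ-∣ (+ k) (subst₂ _∣_ (ℤ.pos-* k n) (factor (+ k) x y) d))
  where factor : ∀ k x y → k * x - k * y ≡ k * (x - y)
        factor = solve-∀

module Residues (p : ℕ) .{{_ : NonZero p}} where

  open PAdic p

  p^n≢0 : ∀ n → NonZero (p ^ n)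
  p^n≢0 n = ℕ.m^n≢0 p n

  -- Instance search cannot produce NonZero (p ^ n) for a variable n.
  _%p^_ : ℕ → ℕ → ℕ
  A %p^ n = ℕ._%_ A (p ^ n) {{p^n≢0 n}}

  res<p^n : ∀ n x → res n x < p ^ n
  res<p^n zero    x = ℕ.s≤s ℕ.z≤n
  res<p^n (suc n) x = begin-strict
    res n x ℕ.+ toℕ (x n) ℕ.* p ^ n  <⟨ ℕ.+-monoˡ-< _ (res<p^n n x) ⟩
    suc (toℕ (x n)) ℕ.* p ^ n         ≤⟨ ℕ.*-monoˡ-≤ (p ^ n) (Fin.toℕ<n (x n)) ⟩
    p ^ suc n                         ∎
    where open ℕ.≤-Reasoning

  ⟦_⟧ : Zp → ℕ → ℤ
  ⟦ x ⟧ n = + res n x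

  -- Coherent integer sequences model ℤ_p as the inverse limit of the ℤ/p^n; unlike the digit
  -- streams of Zp they admit subtraction.
  Coherent : (ℕ → ℤ) → Set
  Coherent S = ∀ i n → S (i ℕ.+ n) ≡ S n [mod p ^ n ]

  res-coherent : ∀ x → Coherent ⟦ x ⟧
  res-coherent x zero    n = ≡-mod-refl
  res-coherent x (suc i) n = ≡-mod-trans top-digit-vanishes (res-coherent x i n)
    where
      d : ℕ
      d = toℕ (x (i ℕ.+ n))
      top-digit-vanishes : + (res (i ℕ.+ n) x ℕ.+ d ℕ.* p ^ (i ℕ.+ n)) ≡ ⟦ x ⟧ (i ℕ.+ n) [mod p ^ n ]
      top-digit-vanishes = subst (λ t → + (res (i ℕ.+ n) x ℕ.+ t) ≡ ⟦ x ⟧ (i ℕ.+ n) [mod p ^ n ])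
        (trans (ℕ.*-assoc d (p ^ i) (p ^ n)) (cong (d ℕ.*_) (sym (ℕ.^-distribˡ-+-* p i n))))
        (+-multiple-≡-mod (res (i ℕ.+ n) x) (d ℕ.* p ^ i))

  ⟦_−_⟧ : Zp → Zp → ℕ → ℤ
  ⟦ x − y ⟧ n = ⟦ x ⟧ n - ⟦ y ⟧ n

  res-difference-coherent : ∀ x y → Coherent ⟦ x − y ⟧
  res-difference-coherent x y i n = +-cong-mod (res-coherent x i n) (-‿cong-mod (res-coherent y i n))

  %p^-digit-split : ∀ A n → A %p^ n ℕ.+ toℕ (digitOf n A) ℕ.* p ^ n ≡ A %p^ suc n
  %p^-digit-split A n = sym (begin
    A % p ^ suc n
      ≡⟨ m≡m%n+[m/n]*n (A % p ^ suc n) (p ^ n) ⟩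
    A % p ^ suc n % p ^ n ℕ.+ (A % (p ℕ.* p ^ n)) / p ^ n ℕ.* p ^ n
      ≡⟨ cong₂ (λ a b → a ℕ.+ b ℕ.* p ^ n) (m∣n⇒o%n%m≡o%m (p ^ n) (p ^ suc n) A (ℕ.divides p refl))
                                           (m%[n*o]/o≡m/o%n A p (p ^ n)) ⟩
    A % p ^ n ℕ.+ (A / p ^ n) % p ℕ.* p ^ n
      ≡⟨ cong (λ d → A % p ^ n ℕ.+ d ℕ.* p ^ n) (sym (Fin.toℕ-fromℕ< (m%n<n (A / p ^ n) p))) ⟩
    A % p ^ n ℕ.+ toℕ (digitOf n A) ℕ.* p ^ n
      ∎)
    where open ≡-Reasoning
          instance _ = p^n≢0 n
                   _ = p^n≢0 (suc n)

  %p^-cong : ∀ {n a b} → + a ≡ + b [mod p ^ n ] → a %p^ n ≡ b %p^ n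
  %p^-cong {n} {a} {b} a≡b = ≡-mod⇒≡ (m%n<n a (p ^ n)) (m%n<n b (p ^ n)) (begin
    + (a % p ^ n)  ≈⟨ %-≡-mod a (p ^ n) ⟩
    + a            ≈⟨ a≡b ⟩
    + b            ≈⟨ %-≡-mod b (p ^ n) ⟨
    + (b % p ^ n)  ∎)
    where open ≡-mod-Reasoning (p ^ n)
          instance _ = p^n≢0 n

  digits : (ℕ → ℕ) → Zp
  digits G i = digitOf i (G i)

  res-digits : ∀ G → (∀ i → + G (suc i) ≡ + G i [mod p ^ suc i ]) →
               ∀ n → ⟦ digits G ⟧ n ≡ + G n [mod p ^ n ]
  res-digits G G-coherent n = subst (λ r → + r ≡ + G n [mod p ^ n ]) (sym (res≡%p^ n))
                                    (%-≡-mod (G n) (p ^ n) {{p^n≢0 n}})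
    where
      res≡%p^ : ∀ n → res n (digits G) ≡ G n %p^ n
      res≡%p^ zero    = sym (n%1≡0 (G 0))
      res≡%p^ (suc n) = begin
        res n (digits G) ℕ.+ toℕ (digitOf n (G n)) ℕ.* p ^ n
          ≡⟨ cong (ℕ._+ toℕ (digitOf n (G n)) ℕ.* p ^ n) (res≡%p^ n) ⟩
        G n %p^ n ℕ.+ toℕ (digitOf n (G n)) ℕ.* p ^ n
          ≡⟨ %p^-digit-split (G n) n ⟩
        G n %p^ suc n
          ≡⟨ %p^-cong {suc n} (≡-mod-sym (G-coherent n)) ⟩
        G (suc n) %p^ suc n
          ∎
        where open ≡-Reasoning

  res-digitwise : (_⊙_ : ℕ → ℕ → ℕ) →
                  (∀ {n a b c d} → + a ≡ + b [mod n ] → + c ≡ + d [mod n ] →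
                                   + (a ⊙ c) ≡ + (b ⊙ d) [mod n ]) →
                  ∀ x y n → ⟦ digits (λ i → res (suc i) x ⊙ res (suc i) y) ⟧ n
                            ≡ + (res n x ⊙ res n y) [mod p ^ n ]
  res-digitwise _⊙_ ⊙-cong x y n =
    ≡-mod-trans (res-digits G (λ i → drop-top-digit (suc i)) n) (drop-top-digit n)
    where
      G : ℕ → ℕ
      G i = res (suc i) x ⊙ res (suc i) y
      drop-top-digit : ∀ i → + (res (suc i) x ⊙ res (suc i) y) ≡ + (res i x ⊙ res i y) [mod p ^ i ]
      drop-top-digit i = ⊙-cong (res-coherent x 1 i) (res-coherent y 1 i)

  res-+Z : ∀ x y n → ⟦ x +Z y ⟧ n ≡ ⟦ x ⟧ n + ⟦ y ⟧ n [mod p ^ n ]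
  res-+Z x y n = ≡-mod-trans (res-digitwise ℕ._+_ +-cong x y n) (≡⇒≡-mod (ℤ.pos-+ (res n x) (res n y)))
    where
      +-cong : ∀ {n a b c d} → + a ≡ + b [mod n ] → + c ≡ + d [mod n ] → + (a ℕ.+ c) ≡ + (b ℕ.+ d) [mod n ]
      +-cong {n} {a} {b} {c} {d} a≡b c≡d =
        subst₂ (λ u v → u ≡ v [mod n ]) (sym (ℤ.pos-+ a c)) (sym (ℤ.pos-+ b d)) (+-cong-mod a≡b c≡d)

  res-*Z : ∀ x y n → ⟦ x *Z y ⟧ n ≡ ⟦ x ⟧ n * ⟦ y ⟧ n [mod p ^ n ]
  res-*Z x y n = ≡-mod-trans (res-digitwise ℕ._*_ *-cong x y n) (≡⇒≡-mod (ℤ.pos-* (res n x) (res n y)))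
    where
      *-cong : ∀ {n a b c d} → + a ≡ + b [mod n ] → + c ≡ + d [mod n ] → + (a ℕ.* c) ≡ + (b ℕ.* d) [mod n ]
      *-cong {n} {a} {b} {c} {d} a≡b c≡d =
        subst₂ (λ u v → u ≡ v [mod n ]) (sym (ℤ.pos-* a c)) (sym (ℤ.pos-* b d)) (*-cong-mod a≡b c≡d)

  res-fromℕZ : ∀ c n → ⟦ fromℕZ c ⟧ n ≡ + c [mod p ^ n ]
  res-fromℕZ c = res-digits (λ _ → c) (λ _ → ≡-mod-refl)

  res-injective : ∀ {n x y} → ⟦ x ⟧ n ≡ ⟦ y ⟧ n [mod p ^ n ] → res n x ≡ res n y
  res-injective {n} {x} {y} = ≡-mod⇒≡ (res<p^n n x) (res<p^n n y)

  res≡⇒≈Z : ∀ {x y} → (∀ n → res n x ≡ res n y) → x ≈Z y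
  res≡⇒≈Z {x} {y} res≡ n = Fin.toℕ-injective (ℕ.*-cancelʳ-≡ _ _ (p ^ n) {{p^n≢0 n}}
    (ℕ.+-cancelˡ-≡ (res n x) _ _ (trans (res≡ (suc n)) (cong (ℕ._+ toℕ (y n) ℕ.* p ^ n) (sym (res≡ n))))))

  pred[p]<p : ℕ.pred p < p
  pred[p]<p = subst (ℕ.pred p <_) (ℕ.suc-pred p) ℕ.≤-refl

  minus-one : Zp
  minus-one _ = fromℕ< pred[p]<p

  res-minus-one : ∀ n → ⟦ minus-one ⟧ n ≡ -1ℤ [mod p ^ n ]
  res-minus-one n = mod-intro (divides 1ℤ (begin
    ⟦ minus-one ⟧ n - -1ℤ         ≡⟨ ℤ.pos-+ (res n minus-one) 1 ⟨
    + (res n minus-one ℕ.+ 1)     ≡⟨ cong +_ (res+1 n) ⟩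
    + (p ^ n)                     ≡⟨ ℤ.*-identityˡ (+ (p ^ n)) ⟨
    1ℤ * + (p ^ n)                ∎))
    where
      open ≡-Reasoning
      res+1 : ∀ n → res n minus-one ℕ.+ 1 ≡ p ^ n
      res+1 zero    = refl
      res+1 (suc n) = begin
        res n minus-one ℕ.+ toℕ (minus-one n) ℕ.* p ^ n ℕ.+ 1
          ≡⟨ cong (λ d → res n minus-one ℕ.+ d ℕ.* p ^ n ℕ.+ 1) (Fin.toℕ-fromℕ< pred[p]<p) ⟩
        res n minus-one ℕ.+ ℕ.pred p ℕ.* p ^ n ℕ.+ 1
          ≡⟨ xy∙z≈xz∙y (res n minus-one) _ 1 ⟩
        res n minus-one ℕ.+ 1 ℕ.+ ℕ.pred p ℕ.* p ^ n
          ≡⟨ cong (ℕ._+ ℕ.pred p ℕ.* p ^ n) (res+1 n) ⟩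
        suc (ℕ.pred p) ℕ.* p ^ n
          ≡⟨ cong (ℕ._* p ^ n) (ℕ.suc-pred p) ⟩
        p ^ suc n
          ∎

  res-negate : ∀ u n → ⟦ minus-one *Z u ⟧ n ≡ - ⟦ u ⟧ n [mod p ^ n ]
  res-negate u n = ≡-mod-trans (res-*Z minus-one u n)
    (≡-mod-trans (*-congʳ-mod (⟦ u ⟧ n) (res-minus-one n)) (≡⇒≡-mod (ℤ.-1*i≡-i (⟦ u ⟧ n))))

module Representation (p : ℕ) .{{_ : NonZero p}} where

  open PAdic p
  open Residues p

  P : ℕ → ℤ
  P j = + (p ^ j)

  P-+ : ∀ i j → P (i ℕ.+ j) ≡ P i * P j
  P-+ i j = trans (cong +_ (ℕ.^-distribˡ-+-* p i j)) (ℤ.pos-* (p ^ i) (p ^ j))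

  P-scale-mod : ∀ i {n x y} → x ≡ y [mod p ^ n ] → P i * x ≡ P i * y [mod p ^ (i ℕ.+ n) ]
  P-scale-mod i {n} x≡y = subst (_ ≡ _ [mod_]) (sym (ℕ.^-distribˡ-+-* p i n)) (*-scale-mod (p ^ i) x≡y)

  P-cancel-mod : ∀ i {n x y} → P i * x ≡ P i * y [mod p ^ (i ℕ.+ n) ] → x ≡ y [mod p ^ n ]
  P-cancel-mod i {n} Px≡Py =
    *-cancel-mod (p ^ i) {{p^n≢0 i}} (subst (_ ≡ _ [mod_]) (ℕ.^-distribˡ-+-* p i n) Px≡Py)

  -- (k , u) ≃ S /p^ j  says  u/p^k = S/p^j  in ℚ_p.
  infix 4 _≃_/p^_
  record _≃_/p^_ (q : Qp) (S : ℕ → ℤ) (j : ℕ) : Set where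
    constructor represents
    field congruence : ∀ n → P j * ⟦ proj₂ q ⟧ n ≡ P (proj₁ q) * S n [mod p ^ n ]
  open _≃_/p^_

  ≃-resp : ∀ {q S T j} → q ≃ S /p^ j → (∀ n → S n ≡ T n [mod p ^ n ]) → q ≃ T /p^ j
  ≃-resp {k , u} q≃S S≡T = represents λ n → ≡-mod-trans (congruence q≃S n) (*-congˡ-mod (P k) (S≡T n))

  ≃-cong-exponent : ∀ {q S i j} → i ≡ j → q ≃ S /p^ i → q ≃ S /p^ j
  ≃-cong-exponent refl q≃S = q≃S

  ι-≃ : ∀ x → ι x ≃ ⟦ x ⟧ /p^ 0
  ι-≃ x = represents λ n → ≡-mod-refl

  coefficient-≃ : ∀ k u {S} → (∀ n → ⟦ u ⟧ n ≡ S n [mod p ^ n ]) → (k , u) ≃ S /p^ k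
  coefficient-≃ k u u≡S = represents λ n → *-congˡ-mod (P k) (u≡S n)

  0Q-≃ : ∀ j → 0Q ≃ (λ _ → 0ℤ) /p^ j
  0Q-≃ j = represents λ n → let open ≡-mod-Reasoning (p ^ n) in begin
    P j * ⟦ 0Z ⟧ n  ≈⟨ *-congˡ-mod (P j) (res-fromℕZ 0 n) ⟩
    P j * 0ℤ        ≡⟨ ℤ.*-zeroʳ (P j) ⟩
    0ℤ              ≡⟨ ℤ.*-zeroʳ (P 0) ⟨
    P 0 * 0ℤ        ∎

  *Q-≃ : ∀ {q r S T i j} → q ≃ S /p^ i → r ≃ T /p^ j → q *Q r ≃ (λ n → S n * T n) /p^ (i ℕ.+ j)
  *Q-≃ {k , u} {l , v} {S} {T} {i} {j} q≃S r≃T = represents λ n → let open ≡-mod-Reasoning (p ^ n) in begin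
    P (i ℕ.+ j) * ⟦ u *Z v ⟧ n         ≈⟨ *-cong-mod (≡⇒≡-mod (P-+ i j)) (res-*Z u v n) ⟩
    P i * P j * (⟦ u ⟧ n * ⟦ v ⟧ n)    ≡⟨ interchange (P i) (P j) (⟦ u ⟧ n) (⟦ v ⟧ n) ⟩
    P i * ⟦ u ⟧ n * (P j * ⟦ v ⟧ n)    ≈⟨ *-cong-mod (congruence q≃S n) (congruence r≃T n) ⟩
    P k * S n * (P l * T n)            ≡⟨ interchange (P k) (S n) (P l) (T n) ⟩
    P k * P l * (S n * T n)            ≡⟨ cong (_* (S n * T n)) (P-+ k l) ⟨
    P (k ℕ.+ l) * (S n * T n)          ∎
    where interchange : ∀ a b c d → a * b * (c * d) ≡ a * c * (b * d)
          interchange = solve-∀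

  res-scaled : ∀ c u n → ⟦ fromℕZ c *Z u ⟧ n ≡ + c * ⟦ u ⟧ n [mod p ^ n ]
  res-scaled c u n = ≡-mod-trans (res-*Z (fromℕZ c) u n) (*-congʳ-mod (⟦ u ⟧ n) (res-fromℕZ c n))

  +Q-≃ : ∀ {q r S T i j} → q ≃ S /p^ i → r ≃ T /p^ j →
         q +Q r ≃ (λ n → P j * S n + P i * T n) /p^ (i ℕ.+ j)
  +Q-≃ {k , u} {l , v} {S} {T} {i} {j} q≃S r≃T = represents λ n → let open ≡-mod-Reasoning (p ^ n) in begin
    P (i ℕ.+ j) * ⟦ (fromℕZ (p ^ l) *Z u) +Z (fromℕZ (p ^ k) *Z v) ⟧ n
      ≈⟨ *-cong-mod (≡⇒≡-mod (P-+ i j))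
                    (≡-mod-trans (res-+Z _ _ n) (+-cong-mod (res-scaled (p ^ l) u n) (res-scaled (p ^ k) v n))) ⟩
    P i * P j * (P l * ⟦ u ⟧ n + P k * ⟦ v ⟧ n)
      ≡⟨ distribute (P i) (P j) (P k) (P l) (⟦ u ⟧ n) (⟦ v ⟧ n) ⟩
    P j * P l * (P i * ⟦ u ⟧ n) + P i * P k * (P j * ⟦ v ⟧ n)
      ≈⟨ +-cong-mod (*-congˡ-mod (P j * P l) (congruence q≃S n)) (*-congˡ-mod (P i * P k) (congruence r≃T n)) ⟩
    P j * P l * (P k * S n) + P i * P k * (P l * T n)
      ≡⟨ collect (P i) (P j) (P k) (P l) (S n) (T n) ⟩
    P k * P l * (P j * S n + P i * T n)
      ≡⟨ cong (_* (P j * S n + P i * T n)) (P-+ k l) ⟨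
    P (k ℕ.+ l) * (P j * S n + P i * T n)
      ∎
    where distribute : ∀ a b c d x y → a * b * (d * x + c * y) ≡ b * d * (a * x) + a * c * (b * y)
          distribute = solve-∀
          collect : ∀ a b c d x y → b * d * (c * x) + a * c * (d * y) ≡ c * d * (b * x + a * y)
          collect = solve-∀

  +Q-zeroʳ-≃ : ∀ {q z S j} → q ≃ S /p^ j → z ≃ (λ _ → 0ℤ) /p^ 0 → q +Q z ≃ S /p^ j
  +Q-zeroʳ-≃ {S = S} {j} q≃S z≃0 = ≃-cong-exponent (ℕ.+-identityʳ j)
    (≃-resp (+Q-≃ q≃S z≃0) λ n → ≡⇒≡-mod (drop-zero (S n) (P j)))
    where drop-zero : ∀ s a → 1ℤ * s + a * 0ℤ ≡ s
          drop-zero = solve-∀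

  ≃-lift : ∀ i {q S j} → q ≃ S /p^ j → q ≃ (λ n → P i * S n) /p^ (j ℕ.+ i)
  ≃-lift i {k , u} {S} {j} q≃S = represents λ n → let open ≡-mod-Reasoning (p ^ n) in begin
    P (j ℕ.+ i) * ⟦ u ⟧ n    ≡⟨ cong (_* ⟦ u ⟧ n) (trans (P-+ j i) (ℤ.*-comm (P j) (P i))) ⟩
    P i * P j * ⟦ u ⟧ n      ≡⟨ ℤ.*-assoc (P i) (P j) (⟦ u ⟧ n) ⟩
    P i * (P j * ⟦ u ⟧ n)    ≈⟨ *-congˡ-mod (P i) (congruence q≃S n) ⟩
    P i * (P k * S n)        ≡⟨ x∙yz≈y∙xz (P i) (P k) (S n) ⟩
    P k * (P i * S n)        ∎

  ≃-cancel : ∀ i {q T j} → q ≃ (λ n → P i * T n) /p^ (j ℕ.+ i) → Coherent T → q ≃ T /p^ j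
  ≃-cancel i {k , u} {T} {j} q≃PT T-coherent = represents λ n → let open ≡-mod-Reasoning (p ^ n) in begin
    P j * ⟦ u ⟧ n            ≈⟨ *-congˡ-mod (P j) (res-coherent u i n) ⟨
    P j * ⟦ u ⟧ (i ℕ.+ n)    ≈⟨ P-cancel-mod i (at (i ℕ.+ n)) ⟩
    P k * T (i ℕ.+ n)        ≈⟨ *-congˡ-mod (P k) (T-coherent i n) ⟩
    P k * T n                ∎
    where
      at : ∀ n → P i * (P j * ⟦ u ⟧ n) ≡ P i * (P k * T n) [mod p ^ n ]
      at n = let open ≡-mod-Reasoning (p ^ n) in begin
        P i * (P j * ⟦ u ⟧ n)    ≡⟨ ℤ.*-assoc (P i) (P j) (⟦ u ⟧ n) ⟨
        P i * P j * ⟦ u ⟧ n      ≡⟨ cong (_* ⟦ u ⟧ n) (trans (ℤ.*-comm (P i) (P j)) (sym (P-+ j i))) ⟩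
        P (j ℕ.+ i) * ⟦ u ⟧ n    ≈⟨ congruence q≃PT n ⟩
        P k * (P i * T n)        ≡⟨ x∙yz≈y∙xz (P k) (P i) (T n) ⟩
        P i * (P k * T n)        ∎

  zero-transfer : ∀ {X Y j k} → Coherent X → Coherent Y → (∀ n → P j * X n ≡ P k * Y n [mod p ^ n ]) →
                  Y j ≡ 0ℤ [mod p ^ j ] → X k ≡ 0ℤ [mod p ^ k ]
  zero-transfer {X} {Y} {j} {k} X-coherent Y-coherent PX≡PY Yj≡0 =
    ≡-mod-trans (≡-mod-sym (X-coherent j k)) (P-cancel-mod j PX≡0)
    where
      PY≡0 : P k * Y (j ℕ.+ k) ≡ P k * 0ℤ [mod p ^ (j ℕ.+ k) ]
      PY≡0 = subst (λ e → P k * Y e ≡ P k * 0ℤ [mod p ^ e ]) (ℕ.+-comm k j)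
                   (P-scale-mod k (≡-mod-trans (Y-coherent k j) Yj≡0))
      PX≡0 : P j * X (j ℕ.+ k) ≡ P j * 0ℤ [mod p ^ (j ℕ.+ k) ]
      PX≡0 = ≡-mod-trans (PX≡PY (j ℕ.+ k))
               (≡-mod-trans PY≡0 (≡⇒≡-mod (trans (ℤ.*-zeroʳ (P k)) (sym (ℤ.*-zeroʳ (P j))))))

  firstZero⇒res≡0 : ∀ k u → T (firstZero k u) → res k u ≡ 0
  firstZero⇒res≡0 zero    u _    = refl
  firstZero⇒res≡0 (suc k) u zeros with Equivalence.to T-∧ zeros
  ... | digit≡0 , rest≡0 =
    cong₂ (λ r d → r ℕ.+ d ℕ.* p ^ k) (firstZero⇒res≡0 k u rest≡0) (ℕ.≡ᵇ⇒≡ (toℕ (u k)) 0 digit≡0)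

  res≡0⇒firstZero : ∀ k u → res k u ≡ 0 → T (firstZero k u)
  res≡0⇒firstZero zero    u _    = _
  res≡0⇒firstZero (suc k) u res≡0 =
    Equivalence.from T-∧ (ℕ.≡⇒≡ᵇ (toℕ (u k)) 0 digit≡0 , res≡0⇒firstZero k u (ℕ.m+n≡0⇒m≡0 (res k u) res≡0))
    where digit≡0 : toℕ (u k) ≡ 0
          digit≡0 = ℕ.m*n≡0⇒m≡0 (toℕ (u k)) (p ^ k) {{p^n≢0 k}} (ℕ.m+n≡0⇒n≡0 (res k u) res≡0)

  inZp?-≃ : ∀ {q S j} → q ≃ S /p^ j → Coherent S → T (inZp? q) ⇔ S j ≡ 0ℤ [mod p ^ j ]
  inZp?-≃ {k , u} {S} {j} q≃S S-coherent = mk⇔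
    (λ inZp → zero-transfer {j = k} {j} S-coherent (res-coherent u) (λ n → ≡-mod-sym (congruence q≃S n))
                            (≡⇒≡-mod (cong +_ (firstZero⇒res≡0 k u inZp))))
    (λ Sj≡0 → res≡0⇒firstZero k u (≡-mod⇒≡ (res<p^n k u) (ℕ.m^n>0 p k)
                                    (zero-transfer {j = j} {k} (res-coherent u) S-coherent (congruence q≃S) Sj≡0)))

  ≃⇒≈Q : ∀ {q t} → q ≃ ⟦ t ⟧ /p^ 0 → q ≈Q ι t
  ≃⇒≈Q {k , u} {t} q≃t = res≡⇒≈Z λ n → res-injective {n} (let open ≡-mod-Reasoning (p ^ n) in begin
    ⟦ fromℕZ 1 *Z u ⟧ n          ≈⟨ res-scaled 1 u n ⟩
    P 0 * ⟦ u ⟧ n                ≈⟨ congruence q≃t n ⟩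
    P k * ⟦ t ⟧ n                ≈⟨ res-scaled (p ^ k) t n ⟨
    ⟦ fromℕZ (p ^ k) *Z t ⟧ n    ∎)

  Σp-≃-integral : ∀ {d} (X : Vecp d) i {S j} → X i ≃ S /p^ j → Coherent S → S j ≡ 0ℤ [mod p ^ j ] →
                  Σp X i ≃ S /p^ j
  Σp-≃-integral X i {S} {j} Xi≃S S-coherent Sj≡0 = subst (_≃ S /p^ j) (sym pReLU-fixes) Xi≃S
    where pReLU-fixes : pReLU (X i) ≡ X i
          pReLU-fixes = cong (if_then X i else 0Q)
            (Equivalence.to T-≡ (Equivalence.from (inZp?-≃ Xi≃S S-coherent) Sj≡0))

  Σp-≃-nonintegral : ∀ {d} (X : Vecp d) i {S j} → X i ≃ S /p^ j → Coherent S → ¬ (S j ≡ 0ℤ [mod p ^ j ]) →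
                     Σp X i ≃ (λ _ → 0ℤ) /p^ j
  Σp-≃-nonintegral X i {S} {j} Xi≃S S-coherent Sj≢0 = subst (_≃ (λ _ → 0ℤ) /p^ j) (sym pReLU-kills) (0Q-≃ j)
    where pReLU-kills : pReLU (X i) ≡ 0Q
          pReLU-kills = cong (if_then X i else 0Q)
            (¬-not λ inZp → Sj≢0 (Equivalence.to (inZp?-≃ Xi≃S S-coherent) (Equivalence.from T-≡ inZp)))

module SelectionNetwork (p : ℕ) .{{_ : NonZero p}} (m : ℕ) where

  open PAdic p
  open Residues p
  open Representation p

  one minus-p^m : Zp
  one       = fromℕZ 1
  minus-p^m = minus-one *Z fromℕZ (p ^ m)

  readout-row : Fin 2 → Qp
  readout-row fzero    = (0 , one)
  readout-row (fsuc _) = (0 , minus-p^m)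

  shift-row : Fin 2 → Qp
  shift-row fzero    = (m , one)
  shift-row (fsuc _) = (0 , minus-one)

  input-layer : Affine 1 2
  Affine.mat  input-layer fzero    _ = (0 , one)
  Affine.mat  input-layer (fsuc _) _ = 0Q
  Affine.bias input-layer _          = 0Q

  -- (v₀ , v₁) ↦ (v₀ − p^m v₁ , (v₀ − a)/p^m − v₁)
  select-layer : Zp → Affine 2 2
  Affine.mat  (select-layer a) fzero    = readout-row
  Affine.mat  (select-layer a) (fsuc _) = shift-row
  Affine.bias (select-layer a) fzero    = 0Q
  Affine.bias (select-layer a) (fsuc _) = (m , minus-one *Z a)

  output-layer : Affine 2 1
  Affine.mat  output-layer _ = readout-row
  Affine.bias output-layer _ = 0Q

  select-layers : List Zp → Net 2 1
  select-layers []       = output output-layer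
  select-layers (a ∷ as) = hidden (select-layer a) (select-layers as)

  network : List Zp → Net 1 1
  network as = hidden input-layer (select-layers as)

  width-network : ∀ as → width (network as) ≡ 2
  width-network []       = refl
  width-network (a ∷ as) = trans (sym (ℕ.⊔-assoc 2 2 (width (select-layers as)))) (width-network as)

  select : Zp → Zp → Zp
  select c a with res m c ℕ.≟ res m a
  ... | yes _ = a
  ... | no  _ = c

  record Encodes (v : Vecp 2) (c : Zp) : Set where
    constructor encodes
    field
      z      : Zp
      first  : v fzero ≃ ⟦ z ⟧ /p^ 0
      second : v (fsuc fzero) ≃ ⟦ z − c ⟧ /p^ m

  one-≃ : ∀ k → (k , one) ≃ (λ _ → 1ℤ) /p^ k
  one-≃ k = coefficient-≃ k one (res-fromℕZ 1)

  minus-one-≃ : (0 , minus-one) ≃ (λ _ → -1ℤ) /p^ 0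
  minus-one-≃ = coefficient-≃ 0 minus-one res-minus-one

  minus-p^m-≃ : (0 , minus-p^m) ≃ (λ _ → - P m) /p^ 0
  minus-p^m-≃ = coefficient-≃ 0 minus-p^m λ n →
    ≡-mod-trans (res-negate (fromℕZ (p ^ m)) n) (-‿cong-mod (res-fromℕZ (p ^ m) n))

  readout-≃ : ∀ {e v c} (A : Affine 2 e) i →
              Affine.mat A i fzero ≃ (λ _ → 1ℤ) /p^ 0 → Affine.mat A i (fsuc fzero) ≃ (λ _ → - P m) /p^ 0 →
              Affine.bias A i ≃ (λ _ → 0ℤ) /p^ 0 → Encodes v c → applyAff A v i ≃ ⟦ c ⟧ /p^ 0
  readout-≃ {v = v} {c} A i w₀≃1 w₁≃-p^m b≃0 (encodes z v₀≃z v₁≃z-c) =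
    ≃-cancel m (≃-resp combination λ n → ≡⇒≡-mod (collapse (P m) (⟦ z ⟧ n) (⟦ c ⟧ n))) (res-coherent c)
    where
      combination : applyAff A v i ≃ (λ n → P m * (1ℤ * ⟦ z ⟧ n) + 1ℤ * (- P m * ⟦ z − c ⟧ n)) /p^ m
      combination = +Q-zeroʳ-≃ (+Q-≃ (*Q-≃ w₀≃1 v₀≃z) (+Q-zeroʳ-≃ (*Q-≃ w₁≃-p^m v₁≃z-c) (0Q-≃ 0))) b≃0
      collapse : ∀ q z c → q * (1ℤ * z) + 1ℤ * (- q * (z - c)) ≡ q * c
      collapse = solve-∀

  shift-≃ : ∀ {v c} a → Encodes v c → applyAff (select-layer a) v (fsuc fzero) ≃ ⟦ c − a ⟧ /p^ m
  shift-≃ {v} {c} a (encodes z v₀≃z v₁≃z-c) =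
    ≃-cancel (m ℕ.+ m)
      (≃-cong-exponent (ℕ.+-assoc m m m)
        (≃-resp combination λ n → ≡⇒≡-mod (collapse (P m) (⟦ z ⟧ n) (⟦ c ⟧ n) (⟦ a ⟧ n) (P-+ m m))))
      (res-difference-coherent c a)
    where
      v₀/p^m : (m , one) *Q v fzero ≃ (λ n → 1ℤ * ⟦ z ⟧ n) /p^ m
      v₀/p^m = ≃-cong-exponent (ℕ.+-identityʳ m) (*Q-≃ (one-≃ m) v₀≃z)
      -a/p^m : (m , minus-one *Z a) ≃ (λ n → - ⟦ a ⟧ n) /p^ m
      -a/p^m = coefficient-≃ m (minus-one *Z a) (res-negate a)
      combination : applyAff (select-layer a) v (fsuc fzero)
                    ≃ (λ n → P m * (P m * (1ℤ * ⟦ z ⟧ n) + P m * (-1ℤ * ⟦ z − c ⟧ n)) + P (m ℕ.+ m) * - ⟦ a ⟧ n)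
                      /p^ (m ℕ.+ m ℕ.+ m)
      combination = +Q-≃ (+Q-≃ v₀/p^m (+Q-zeroʳ-≃ (*Q-≃ minus-one-≃ v₁≃z-c) (0Q-≃ 0))) -a/p^m
      collapse-identity : ∀ q z c a → q * (q * (1ℤ * z) + q * (-1ℤ * (z - c))) + q * q * - a ≡ q * q * (c - a)
      collapse-identity = solve-∀
      collapse : ∀ {Q} q z c a → Q ≡ q * q → q * (q * (1ℤ * z) + q * (-1ℤ * (z - c))) + Q * - a ≡ Q * (c - a)
      collapse q z c a refl = collapse-identity q z c a

  input-encodes : ∀ x → Encodes (Σp (applyAff input-layer (λ _ → ι x))) x
  input-encodes x = encodes x
    (Σp-≃-integral (applyAff input-layer (λ _ → ι x)) fzero x-row (res-coherent x) ≡-mod-1)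
    (Σp-≃-integral (applyAff input-layer (λ _ → ι x)) (fsuc fzero) zero-row (res-difference-coherent x x)
                   (≡⇒≡-mod (ℤ.+-inverseʳ (⟦ x ⟧ m))))
    where
      x-row : applyAff input-layer (λ _ → ι x) fzero ≃ ⟦ x ⟧ /p^ 0
      x-row = ≃-resp (+Q-zeroʳ-≃ (+Q-zeroʳ-≃ (*Q-≃ (one-≃ 0) (ι-≃ x)) (0Q-≃ 0)) (0Q-≃ 0))
                     λ n → ≡⇒≡-mod (ℤ.*-identityˡ (⟦ x ⟧ n))
      zero-row : applyAff input-layer (λ _ → ι x) (fsuc fzero) ≃ ⟦ x − x ⟧ /p^ m
      zero-row = ≃-resp (≃-lift m (+Q-zeroʳ-≃ (+Q-zeroʳ-≃ (*Q-≃ (0Q-≃ 0) (ι-≃ x)) (0Q-≃ 0)) (0Q-≃ 0)))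
                        λ n → ≡⇒≡-mod (vanish (P m) (⟦ x ⟧ n))
        where vanish : ∀ q x → q * (0ℤ * x) ≡ x - x
              vanish = solve-∀

  Σp-shift-≃ : ∀ {d} (X : Vecp d) i {c a} → X i ≃ ⟦ c − a ⟧ /p^ m → Σp X i ≃ ⟦ c − select c a ⟧ /p^ m
  Σp-shift-≃ X i {c} {a} Xi≃c-a with res m c ℕ.≟ res m a
  ... | yes c≡a = Σp-≃-integral X i Xi≃c-a (res-difference-coherent c a) (x≡y⇒x-y≡0-mod (≡⇒≡-mod (cong +_ c≡a)))
  ... | no  c≢a = ≃-resp (Σp-≃-nonintegral X i Xi≃c-a (res-difference-coherent c a)
                                              (c≢a ∘ res-injective {m} {c} {a} ∘ x-y≡0⇒x≡y-mod))
                         λ n → ≡⇒≡-mod (sym (ℤ.+-inverseʳ (⟦ c ⟧ n)))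

  -- The implicit arguments are given explicitly: inferring them makes Agda unfold the layer
  -- outputs into huge digit-stream terms.
  select-layer-encodes : ∀ {v c} a → Encodes v c → Encodes (Σp (applyAff (select-layer a) v)) (select c a)
  select-layer-encodes {v} {c} a enc =
    encodes c (Σp-≃-integral (applyAff (select-layer a) v) fzero readout (res-coherent c) ≡-mod-1)
              (Σp-shift-≃ (applyAff (select-layer a) v) (fsuc fzero) {c} {a} (shift-≃ {v} {c} a enc))
    where
      readout : applyAff (select-layer a) v fzero ≃ ⟦ c ⟧ /p^ 0
      readout = readout-≃ {v = v} {c} (select-layer a) fzero (one-≃ 0) minus-p^m-≃ (0Q-≃ 0) enc

  select-layers-≃ : ∀ as {v c} → Encodes v c → eval (select-layers as) v fzero ≃ ⟦ foldl select c as ⟧ /p^ 0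
  select-layers-≃ []       {v} {c} enc = readout-≃ {v = v} {c} output-layer fzero (one-≃ 0) minus-p^m-≃ (0Q-≃ 0) enc
  select-layers-≃ (a ∷ as) {v} {c} enc =
    select-layers-≃ as (select-layer-encodes {v} {c} a enc)

  network-≃ : ∀ as x → eval (network as) (λ _ → ι x) fzero ≃ ⟦ foldl select x as ⟧ /p^ 0
  network-≃ as x = select-layers-≃ as (input-encodes x)

  module _ (α : Fin (p ^ m) → Zp) (α-res : ∀ r → res m (α r) ≡ toℕ r) where

    foldl-select-representatives : ∀ {r} rs c → res m c ≡ toℕ r → c ≡ α r ⊎ r ∈ rs →
                                   foldl select c (map α rs) ≡ α r
    foldl-select-representatives [] c _ (inj₁ c≡αr) = c≡αr
    foldl-select-representatives {r} (r′ ∷ rs) c c∈r pending with res m c ℕ.≟ res m (α r′)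
    ... | yes c≡αr′ = foldl-select-representatives rs (α r′) (trans (α-res r′) (cong toℕ (sym r≡r′)))
                                                   (inj₁ (cong α (sym r≡r′)))
      where r≡r′ : r ≡ r′
            r≡r′ = Fin.toℕ-injective (trans (sym c∈r) (trans c≡αr′ (α-res r′)))
    ... | no  c≢αr′ = foldl-select-representatives rs c c∈r (still-pending pending)
      where still-pending : c ≡ α r ⊎ r ∈ r′ ∷ rs → c ≡ α r ⊎ r ∈ rs
            still-pending (inj₁ c≡αr)         = inj₁ c≡αr
            still-pending (inj₂ (here r≡r′))  =
              contradiction (trans c∈r (trans (cong toℕ r≡r′) (sym (α-res r′)))) c≢αr′
            still-pending (inj₂ (there r∈rs)) = inj₂ r∈rs

lemma3p9 : (p : ℕ) .{{nz : NonZero p}} → Prime p → (m : ℕ) → m > 0 →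
    let open PAdic p in
    (α : Fin (p ^ m) → Zp) → (∀ r → res m (α r) ≡ toℕ r) →
    Σ (Net 1 1) λ N → (width N ≡ 2) ×
      (∀ (x : Zp) (r : Fin (p ^ m)) → res m x ≡ toℕ r →
        eval N (λ _ → ι x) fzero ≈Q ι (α r))
lemma3p9 p _ m _ α α-res = network representatives , width-network representatives , correct
  where
    open PAdic p
    open Residues p
    open Representation p
    open SelectionNetwork p m
    representatives : List Zp
    representatives = map α (allFin (p ^ m))
    correct : ∀ x r → res m x ≡ toℕ r → eval (network representatives) (λ _ → ι x) fzero ≈Q ι (α r)
    correct x r x∈r = ≃⇒≈Q (subst (λ c → eval (network representatives) (λ _ → ι x) fzero ≃ ⟦ c ⟧ /p^ 0)
      (foldl-select-representatives α α-res (allFin (p ^ m)) x x∈r (inj₂ (∈-allFin r)))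
      (network-≃ representatives x))
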